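{- Let $t\in\mathbb{N}$ and let $H$ be a graph with vertex set $A\cup T$ such that: (1) $|A|\ge 3t^2+t+1$; (2) $A$ is a clique in $H$; (3) $T=V(Q_1)\cup V(Q_2)\cup V(Q_3)$, where $Q_1,Q_2,Q_3$ are paths in $H$ from a vertex $w\notin A$ to $A$ such that $Q_1-w$, $Q_2-w$, $Q_3-w$ are pairwise vertex-disjoint; (4) $\deg_H(w)=3$; (5) $|A\cap T|=3$, and the three vertices of $A\cap T$ are the endpoints $y_1,y_2,y_3$ of $Q_1,Q_2,Q_3$, respectively, different from $w$; (6) $H[V(Q_1)\cup V(Q_2)]$ is a chordless cycle; (7) $A\setminus T$ and $T\setminus A$ are anticomplete to each other. Then $H\xrightarrow{\cap}tS_{t,t,t}$.
   Context: All graphs are finite and simple. For graphs $G_1=(V_1,E_1)$, $G_2=(V_2,E_2)$, $G_1\cap G_2=(V_1\cap V_2,E_1\cap E_2)$. For $G=(V,E)$ and an injective map $\alpha$ on $V$, $G^{\alpha}$ has vertex set $\alpha(V)$ and edge set $\{\{\alpha(v),\alpha(w)\}:\{v,w\}\in E\}$. We write $G\xrightarrow{\cap}H$ if $H=G^{\alpha_1}\cap\cdots\cap G^{\alpha_k}$ for some injective maps $\alpha_1,\dots,\alpha_k$ on $V(G)$ (up to isomorphism of $H$). $S_{t,t,t}$ is obtained from $K_{1,3}$ by subdividing each edge with $t-1$ new vertices; $tS_{t,t,t}$ is the disjoint union of $t$ copies. Sets $X,Y$ are anticomplete if no vertex of $X$ is adjacent to a vertex of $Y$. -}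

module Defs where

open import Data.Nat using (ℕ; zero; suc; _+_; _*_; _≤_; _%_)
open import Data.Fin using (Fin; toℕ)
open import Data.Fin.Subset using (Subset; _∈_; _∉_; _∩_; ∣_∣)
open import Data.Bool using (Bool; true; false)
open import Data.Vec using (tabulate)
open import Data.List using (List; []; _∷_)
open import Data.List.Relation.Unary.Unique.Propositional using (Unique)
open import Data.Maybe using (Maybe; just; nothing)
open import Data.Product using (Σ; ∃; _×_; _,_)
open import Data.Sum using (_⊎_)
open import Relation.Binary.PropositionalEquality using (_≡_; _≢_)
open import Relation.Nullary using (¬_)
open import Function.Definitions using (Injective)
open import Function.Bundles using (_⇔_)

record Graph : Set where
  field
    n      : ℕ
    adj    : Fin n → Fin n → Bool
    sym    : ∀ u v → adj u v ≡ adj v u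
    irrefl : ∀ u → adj u u ≡ false
open Graph public

deg : (G : Graph) → Fin (n G) → ℕ
deg G v = ∣ tabulate (adj G v) ∣

data WalkList (G : Graph) : Fin (n G) → Fin (n G) → List (Fin (n G)) → Set where
  single : ∀ u → WalkList G u u (u ∷ [])
  step   : ∀ {u v w xs} → adj G u v ≡ true → WalkList G v w xs →
           WalkList G u w (u ∷ xs)

IsPath : (G : Graph) → Fin (n G) → Fin (n G) → List (Fin (n G)) → Set
IsPath G u v xs = WalkList G u v xs × Unique xs

-- The induced subgraph G[S] (S given by a membership predicate) is a
-- chordless cycle: there are m = 3 + k ≥ 3 distinct vertices c₀,…,c_{m-1}
-- forming exactly S, and c_i c_j is an edge iff i, j are cyclically consecutive.
InducesCycle : (G : Graph) → (Fin (n G) → Set) → Set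
InducesCycle G S =
  Σ ℕ λ k → Σ (Fin (3 + k) → Fin (n G)) λ c →
    Injective _≡_ _≡_ c ×
    (∀ v → S v ⇔ (∃ λ i → c i ≡ v)) ×
    (∀ i j → (adj G (c i) (c j) ≡ true) ⇔
       ((toℕ j ≡ (suc (toℕ i)) % (3 + k)) ⊎ (toℕ i ≡ (suc (toℕ j)) % (3 + k))))

-- G →∩ (V , E): the graph with vertex type V and adjacency E is isomorphic
-- to G^{α₁} ∩ ⋯ ∩ G^{α_k} for some k ≥ 1 and injective α_i : V(G) → ℕ.
-- The isomorphism is φ : V → ℕ, an injection onto the common vertex set
-- ⋂ α_i(V(G)), with E u v iff {φ u, φ v} is an edge of every G^{α_i}.

IntersectsTo : (G : Graph) → (V : Set) → (V → V → Set) → Set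
IntersectsTo G V E =
  Σ ℕ λ k → 1 ≤ k × Σ (Fin k → Fin (n G) → ℕ) λ α →
    (∀ i → Injective _≡_ _≡_ (α i)) ×
    Σ (V → ℕ) λ φ →
      Injective _≡_ _≡_ φ ×
      (∀ x → (∃ λ v → φ v ≡ x) ⇔ (∀ i → ∃ λ a → α i a ≡ x)) ×
      (∀ u v → E u v ⇔
         (∀ i → ∃ λ a → ∃ λ b → α i a ≡ φ u × α i b ≡ φ v × adj G a b ≡ true))

-- t S_{t,t,t}: copies indexed by Fin t; each copy has a centre (nothing)
-- and three legs (Fin 3), leg vertices at distances 1..t from the centre
-- indexed by Fin t (index i = distance i+1).

tSttt-V : ℕ → Set
tSttt-V t = Fin t × Maybe (Fin 3 × Fin t)

data tSttt-Arc (t : ℕ) : tSttt-V t → tSttt-V t → Set where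
  hub : ∀ c l i → toℕ i ≡ 0 → tSttt-Arc t (c , nothing) (c , just (l , i))
  leg : ∀ c l i j → toℕ j ≡ suc (toℕ i) →
        tSttt-Arc t (c , just (l , i)) (c , just (l , j))

tSttt-E : (t : ℕ) → tSttt-V t → tSttt-V t → Set
tSttt-E t u v = tSttt-Arc t u v ⊎ tSttt-Arc t v u

-- For every vertex x of tS_{t,t,t} we embed tS_{t,t,t} into H (an injective
-- homomorphism) so that every non-neighbour of x goes to a non-neighbour of the
-- image of x.  Relabelling H along each of these embeddings, with private labels
-- for the vertices they miss, makes the intersection of the relabelled copies of
-- H exactly tS_{t,t,t}.
--
-- A leg vertex x is laid, with the line through x and its centre, along the path
-- y₁ … w … y₂ around the chordless cycle Q₁ ∪ Q₂, x landing on the neighbour of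
-- y₁.  That vertex has no further neighbours on the cycle and lies in T ∖ A, which
-- is anticomplete to A ∖ T.  A centre goes to w, its legs along Q₁, Q₂, Q₃.  In
-- both cases the vertices placed on T form paths ending in A, and all others are
-- sent injectively into A ∖ T, where the clique A supplies the remaining edges.
-- At least two vertices always land on T, so 3t² + t − 2 vertices of A ∖ T are
-- enough; (1) and (5) provide them.

module Submission where

open import Defs hiding (sym)
open import Data.Nat using (ℕ; zero; suc; _+_; _*_; _∸_; _≤_; _<_; s≤s; s≤s⁻¹; z≤n; _≤?_; _%_; NonZero)
import Data.Nat.Properties as ℕ
open import Data.Nat.DivMod using (m<n⇒m%n≡m; n%n≡0)
open import Data.Fin using (Fin; zero; suc; toℕ; punchOut; combine; remQuot; inject₁; _≟_)
open import Data.Fin.Patterns using (0F; 1F; 2F)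
open import Data.Fin.Properties
  using (punchOut-injective; toℕ-injective; toℕ<n; combine-injective; any?; remQuot-combine; toℕ-inject₁)
import Data.Fin.Properties as Fin
open import Data.Fin.Subset using (Subset; _∈_; _∉_; _∩_; ∁; ∣_∣; inside; outside)
open import Data.Fin.Subset.Properties using (x∈p∩q⁺; x∈p∩q⁻; x∈∁p⇒x∉p)
open import Data.Vec using (_∷_; []; here; there)
open import Data.Bool using (true; false)
open import Data.Bool.Properties using (¬-not)
open import Data.Maybe using (nothing; just)
open import Data.List using (List; _∷_; _++_; reverse)
open import Data.List.Properties using (unfold-reverse)
open import Data.List.Membership.Propositional using () renaming (_∈_ to _∈ₗ_)
open import Data.List.Membership.Propositional.Properties using (∈-++⁻; ∈-++⁺ˡ)
open import Data.List.Relation.Unary.Any using (here; there)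
import Data.List.Relation.Unary.Any.Properties as Any
open import Data.List.Relation.Unary.All as All using ()
open import Data.List.Relation.Unary.AllPairs using (_∷_)
open import Data.List.Relation.Unary.Unique.Propositional using (Unique)
open import Data.List.Relation.Unary.Unique.Propositional.Properties using (++⁺)
import Data.List.Relation.Binary.Permutation.Setoid as Permutation
import Data.List.Relation.Binary.Permutation.Setoid.Properties as PermutationProperties
open import Data.Product using (Σ; ∃; _×_; _,_; proj₁; proj₂)
open import Data.Sum using (_⊎_; inj₁; inj₂; [_,_])
import Data.Sum
open import Data.Empty using (⊥)
open import Relation.Binary.PropositionalEquality hiding ([_])
open import Relation.Nullary using (¬_; Dec; yes; no; contradiction)
open import Relation.Nullary.Decidable using (_×-dec_; _⊎-dec_)
import Relation.Nullary.Decidable as Dec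
open import Function.Base using (_∘_)
open import Function.Bundles using (_⇔_; mk⇔; Equivalence)
open import Function.Definitions using (Injective)

-- Finite sets

punchOut₂ : ∀ {m} {i j k : Fin (suc (suc m))} → i ≢ j → i ≢ k → j ≢ k → Fin m
punchOut₂ i≢j i≢k j≢k = punchOut (j≢k ∘ punchOut-injective i≢j i≢k)

punchOut₂-injective : ∀ {m} {i j k k′ : Fin (suc (suc m))}
  (i≢j : i ≢ j) (i≢k : i ≢ k) (j≢k : j ≢ k) (i≢k′ : i ≢ k′) (j≢k′ : j ≢ k′) →
  punchOut₂ i≢j i≢k j≢k ≡ punchOut₂ i≢j i≢k′ j≢k′ → k ≡ k′
punchOut₂-injective i≢j i≢k j≢k i≢k′ j≢k′ =
  punchOut-injective i≢k i≢k′ ∘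
  punchOut-injective (j≢k ∘ punchOut-injective i≢j i≢k) (j≢k′ ∘ punchOut-injective i≢j i≢k′)

∣p∣≡∣p∩q∣+∣p∩∁q∣ : ∀ {n} (p q : Subset n) → ∣ p ∣ ≡ ∣ p ∩ q ∣ + ∣ p ∩ ∁ q ∣
∣p∣≡∣p∩q∣+∣p∩∁q∣ [] [] = refl
∣p∣≡∣p∩q∣+∣p∩∁q∣ (outside ∷ p) (_ ∷ q) = ∣p∣≡∣p∩q∣+∣p∩∁q∣ p q
∣p∣≡∣p∩q∣+∣p∩∁q∣ (inside ∷ p) (inside ∷ q) = cong suc (∣p∣≡∣p∩q∣+∣p∩∁q∣ p q)
∣p∣≡∣p∩q∣+∣p∩∁q∣ (inside ∷ p) (outside ∷ q) =
  trans (cong suc (∣p∣≡∣p∩q∣+∣p∩∁q∣ p q)) (sym (ℕ.+-suc ∣ p ∩ q ∣ ∣ p ∩ ∁ q ∣))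

enumerate : ∀ {n m} (p : Subset n) → m ≤ ∣ p ∣ →
  Σ (Fin m → Fin n) λ f → Injective _≡_ _≡_ f × (∀ i → f i ∈ p)
enumerate {m = zero} p _ = (λ ()) , (λ { {()} }) , λ ()
enumerate {m = suc m} (inside ∷ p) (s≤s m≤∣p∣) with enumerate p m≤∣p∣
... | f , f-injective , f∈p = g , g-injective , g∈p
  where
  g : Fin (suc m) → Fin _
  g zero = zero
  g (suc i) = suc (f i)
  g-injective : Injective _≡_ _≡_ g
  g-injective {zero} {zero} _ = refl
  g-injective {suc i} {suc j} eq = cong suc (f-injective (Fin.suc-injective eq))
  g∈p : ∀ i → g i ∈ inside ∷ p
  g∈p zero = here
  g∈p (suc i) = there (f∈p i)
enumerate {m = suc m} (outside ∷ p) m≤∣p∣ with enumerate p m≤∣p∣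
... | f , f-injective , f∈p =
  suc ∘ f , f-injective ∘ Fin.suc-injective , there ∘ f∈p

-- Chordless cycles

suc-mod : ∀ {m a} .{{_ : NonZero m}} → a < m → suc a % m ≡ suc a ⊎ (suc a ≡ m × suc a % m ≡ 0)
suc-mod {a = a} a<m with ℕ.m≤n⇒m<n∨m≡n a<m
... | inj₁ 1+a<m = inj₁ (m<n⇒m%n≡m 1+a<m)
... | inj₂ refl = inj₂ (refl , n%n≡0 (suc a))

suc-mod-injective : ∀ {m a b} .{{_ : NonZero m}} → a < m → b < m → suc a % m ≡ suc b % m → a ≡ b
suc-mod-injective a<m b<m eq with suc-mod a<m | suc-mod b<m
... | inj₁ p | inj₁ q = ℕ.suc-injective (trans (sym p) (trans eq q))
... | inj₁ p | inj₂ (_ , q) = contradiction (trans (sym p) (trans eq q)) ℕ.1+n≢0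
... | inj₂ (_ , p) | inj₁ q = contradiction (trans (sym q) (trans (sym eq) p)) ℕ.1+n≢0
... | inj₂ (p , _) | inj₂ (q , _) = ℕ.suc-injective (trans p (sym q))

Consecutive : ∀ {m} .{{_ : NonZero m}} → Fin m → Fin m → Set
Consecutive {m} i j = toℕ j ≡ suc (toℕ i) % m ⊎ toℕ i ≡ suc (toℕ j) % m

module _ {m} .{{_ : NonZero m}} {i a b : Fin m} where

  successor-unique : toℕ a ≡ suc (toℕ i) % m → toℕ b ≡ suc (toℕ i) % m → a ≡ b
  successor-unique p q = toℕ-injective (trans p (sym q))

  predecessor-unique : toℕ i ≡ suc (toℕ a) % m → toℕ i ≡ suc (toℕ b) % m → a ≡ b
  predecessor-unique p q = toℕ-injective (suc-mod-injective (toℕ<n a) (toℕ<n b) (trans (sym p) q))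

consecutive-pigeonhole : ∀ {m} .{{_ : NonZero m}} {i a b d : Fin m} →
  Consecutive i a → Consecutive i b → Consecutive i d → a ≡ b ⊎ a ≡ d ⊎ b ≡ d
consecutive-pigeonhole (inj₁ a) (inj₁ b) _ = inj₁ (successor-unique a b)
consecutive-pigeonhole (inj₂ a) (inj₂ b) _ = inj₁ (predecessor-unique a b)
consecutive-pigeonhole (inj₁ a) (inj₂ b) (inj₁ d) = inj₂ (inj₁ (successor-unique a d))
consecutive-pigeonhole (inj₁ a) (inj₂ b) (inj₂ d) = inj₂ (inj₂ (predecessor-unique b d))
consecutive-pigeonhole (inj₂ a) (inj₁ b) (inj₁ d) = inj₂ (inj₂ (successor-unique b d))
consecutive-pigeonhole (inj₂ a) (inj₁ b) (inj₂ d) = inj₂ (inj₁ (predecessor-unique a d))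

induced-cycle-¬three-neighbours : ∀ {H S} → InducesCycle H S →
  ∀ {z a b d} → S z → S a → S b → S d → a ≢ b → a ≢ d → b ≢ d →
  adj H z a ≡ true → adj H z b ≡ true → adj H z d ≡ true → ⊥
induced-cycle-¬three-neighbours (_ , c , _ , member , adjacent) z∈S a∈S b∈S d∈S a≢b a≢d b≢d za zb zd
  with Equivalence.to (member _) z∈S | Equivalence.to (member _) a∈S
     | Equivalence.to (member _) b∈S | Equivalence.to (member _) d∈S
... | i , refl | ia , refl | ib , refl | id , refl
  with consecutive-pigeonhole (Equivalence.to (adjacent i ia) za)
         (Equivalence.to (adjacent i ib) zb) (Equivalence.to (adjacent i id) zd)
... | inj₁ refl = a≢b refl
... | inj₂ (inj₁ refl) = a≢d refl
... | inj₂ (inj₂ refl) = b≢d refl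
-- Walks

module _ {G : Graph} where

  len : ∀ {u v xs} → WalkList G u v xs → ℕ
  len (single _) = 0
  len (step _ p) = suc (len p)

  -- The walk stays at its last vertex beyond its length.
  _‼_ : ∀ {u v xs} → WalkList G u v xs → ℕ → Fin (n G)
  single u ‼ _ = u
  step {u} _ p ‼ zero = u
  step _ p ‼ suc j = p ‼ j

  ‼-zero : ∀ {u v xs} (p : WalkList G u v xs) → p ‼ 0 ≡ u
  ‼-zero (single _) = refl
  ‼-zero (step _ _) = refl

  ‼-len : ∀ {u v xs} (p : WalkList G u v xs) → p ‼ len p ≡ v
  ‼-len (single _) = refl
  ‼-len (step _ p) = ‼-len p

  ‼-adjacent : ∀ {u v xs} (p : WalkList G u v xs) {j} → j < len p →
               adj G (p ‼ j) (p ‼ suc j) ≡ true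
  ‼-adjacent (step e p) {zero} _ = subst (λ x → adj G _ x ≡ true) (sym (‼-zero p)) e
  ‼-adjacent (step _ p) {suc j} (s≤s j<len) = ‼-adjacent p j<len

  ‼-∈ : ∀ {u v xs} (p : WalkList G u v xs) j → p ‼ j ∈ₗ xs
  ‼-∈ (single _) _ = here refl
  ‼-∈ (step _ _) zero = here refl
  ‼-∈ (step _ p) (suc j) = there (‼-∈ p j)

  ‼-injective : ∀ {u v xs} (p : WalkList G u v xs) → Unique xs → ∀ {i j} →
                i ≤ len p → j ≤ len p → p ‼ i ≡ p ‼ j → i ≡ j
  ‼-injective p _ {zero} {zero} _ _ _ = refl
  ‼-injective (step _ p) (u∉xs ∷ _) {zero} {suc j} _ _ eq = contradiction eq (All.lookup u∉xs (‼-∈ p j))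
  ‼-injective (step _ p) (u∉xs ∷ _) {suc i} {zero} _ _ eq = contradiction (sym eq) (All.lookup u∉xs (‼-∈ p i))
  ‼-injective (step _ p) (_ ∷ xs-unique) {suc i} {suc j} (s≤s i≤len) (s≤s j≤len) eq =
    cong suc (‼-injective p xs-unique i≤len j≤len eq)

  len-positive : ∀ {u v xs} (p : WalkList G u v xs) → u ≢ v → 1 ≤ len p
  len-positive (single _) u≢u = contradiction refl u≢u
  len-positive (step _ _) _ = s≤s z≤n

  join : ∀ {u v x y xs ys} → WalkList G u v xs → adj G v x ≡ true → WalkList G x y ys →
         WalkList G u y (xs ++ ys)
  join (single _) e q = step e q
  join (step e′ p) e q = step e′ (join p e q)

  reverseʷ : ∀ {u v xs} → WalkList G u v xs → WalkList G v u (reverse xs)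
  reverseʷ (single u) = single u
  reverseʷ (step {u} {xs = xs} e p) =
    subst (WalkList G _ u) (sym (unfold-reverse u xs)) (join (reverseʷ p) (trans (Graph.sym G _ _) e) (single u))

  ‼-surjective : ∀ {u v xs} (p : WalkList G u v xs) {x} → x ∈ₗ xs → ∃ λ j → j ≤ len p × p ‼ j ≡ x
  ‼-surjective (single _) (here refl) = 0 , z≤n , refl
  ‼-surjective (step _ _) (here refl) = 0 , z≤n , refl
  ‼-surjective (step _ p) (there x∈xs) with ‼-surjective p x∈xs
  ... | j , j≤len , p‼j≡x = suc j , s≤s j≤len , p‼j≡x

Unique-reverse : ∀ {X : Set} {xs : List X} → Unique xs → Unique (reverse xs)
Unique-reverse {X} {xs} = Unique-resp-↭ (↭-sym (↭-reverse xs))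
  where
  open Permutation (setoid X) using (↭-sym)
  open PermutationProperties (setoid X) using (Unique-resp-↭; ↭-reverse)

-- Representing a graph as an intersection

record Embedding (G : Graph) {V : Set} (R : V → V → Set) : Set where
  field
    map : V → Fin (n G)
    injective : Injective _≡_ _≡_ map
    preserves : ∀ {u v} → R u v → adj G (map u) (map v) ≡ true

open Embedding using (map)

symmetrise : ∀ {G V} {R : V → V → Set} → Embedding G R → Embedding G (λ u v → R u v ⊎ R v u)
symmetrise {G} e = record
  { map = map e
  ; injective = Embedding.injective e
  ; preserves = λ { (inj₁ r) → Embedding.preserves e r
                  ; (inj₂ r) → trans (Graph.sym G _ _) (Embedding.preserves e r) }
  }

-- Each map α i sends the image of e i to the common labels φ V and everything
-- else to labels private to i; with two maps the private labels drop out of the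
-- intersection, and a non-edge is killed by the map that separates it.
module FromSeparatingEmbeddings
  (G : Graph) {V : Set} {N : ℕ} (E : V → V → Set) (E? : ∀ u v → Dec (E u v))
  (code : V → Fin N) (decode : Fin N → V) (decode-code : ∀ v → decode (code v) ≡ v)
  {k : ℕ} (e : Fin (2 + k) → Embedding G E)
  (separating : ∀ u v → ¬ E u v → ∃ λ i → adj G (map (e i) u) (map (e i) v) ≡ false) where

  φ : V → ℕ
  φ u = toℕ (code u)

  φ-injective : Injective _≡_ _≡_ φ
  φ-injective {u} {v} eq = begin
    u                 ≡⟨ decode-code u ⟨
    decode (code u)   ≡⟨ cong decode (toℕ-injective eq) ⟩
    decode (code v)   ≡⟨ decode-code v ⟩
    v                 ∎
    where open ≡-Reasoning

  private
    private-label : Fin (2 + k) → Fin (n G) → ℕ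
    private-label i h = N + toℕ (combine i h)

    φ≢private-label : ∀ u i h → φ u ≢ private-label i h
    φ≢private-label u i h = ℕ.<⇒≢ (ℕ.<-≤-trans (toℕ<n (code u)) (ℕ.m≤m+n N _))

    private-label-injective : ∀ i j g h → private-label i g ≡ private-label j h → i ≡ j × g ≡ h
    private-label-injective _ _ _ _ eq = combine-injective _ _ _ _ (toℕ-injective (ℕ.+-cancelˡ-≡ N _ _ eq))

    in-image? : ∀ i h → Dec (∃ λ u → map (e i) u ≡ h)
    in-image? i h = Dec.map′ (λ (f , eq) → decode f , eq)
      (λ (u , eq) → code u , subst (λ v → map (e i) v ≡ h) (sym (decode-code u)) eq)
      (any? λ f → map (e i) (decode f) ≟ h)

  α : Fin (2 + k) → Fin (n G) → ℕ
  α i h with in-image? i h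
  ... | yes (u , _) = φ u
  ... | no _ = private-label i h

  private
    α-cases : ∀ i h → (∃ λ u → map (e i) u ≡ h × α i h ≡ φ u) ⊎ α i h ≡ private-label i h
    α-cases i h with in-image? i h
    ... | yes (u , eq) = inj₁ (u , eq , refl)
    ... | no _ = inj₂ refl

  α-image : ∀ i u → α i (map (e i) u) ≡ φ u
  α-image i u with in-image? i (map (e i) u)
  ... | yes (v , eq) = cong φ (Embedding.injective (e i) eq)
  ... | no ∉image = contradiction (u , refl) ∉image

  α≡φ⇒image : ∀ i h u → α i h ≡ φ u → h ≡ map (e i) u
  α≡φ⇒image i h u eq with α-cases i h
  ... | inj₁ (v , refl , α≡φv) = cong (map (e i)) (φ-injective (trans (sym α≡φv) eq))
  ... | inj₂ α≡private = contradiction (trans (sym eq) α≡private) (φ≢private-label u i h)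

  α-injective : ∀ i → Injective _≡_ _≡_ (α i)
  α-injective i {g} {h} eq with α-cases i g
  ... | inj₁ (u , refl , α≡φu) = sym (α≡φ⇒image i h u (trans (sym eq) α≡φu))
  ... | inj₂ αg≡private with α-cases i h
  ...   | inj₁ (v , _ , α≡φv) =
          contradiction (trans (sym α≡φv) (trans (sym eq) αg≡private)) (φ≢private-label v i g)
  ...   | inj₂ αh≡private =
          proj₂ (private-label-injective i i g h (trans (sym αg≡private) (trans eq αh≡private)))

  common-labels : ∀ x → (∃ λ v → φ v ≡ x) ⇔ (∀ i → ∃ λ a → α i a ≡ x)
  common-labels x = mk⇔ (λ { (v , refl) i → map (e i) v , α-image i v }) from
    where
    from : (∀ i → ∃ λ a → α i a ≡ x) → ∃ λ v → φ v ≡ x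
    from hit with hit zero | hit (suc zero)
    ... | a , refl | b , αb≡αa with α-cases zero a | α-cases (suc zero) b
    ...   | inj₁ (u , _ , α≡φu) | _ = u , sym α≡φu
    ...   | inj₂ _ | inj₁ (u , _ , α≡φu) = u , trans (sym α≡φu) αb≡αa
    ...   | inj₂ αa≡private | inj₂ αb≡private
          with () ← private-label-injective zero (suc zero) a b
                      (trans (sym αa≡private) (trans (sym αb≡αa) αb≡private))

  common-edges : ∀ u v → E u v ⇔ (∀ i → ∃ λ a → ∃ λ b → α i a ≡ φ u × α i b ≡ φ v × adj G a b ≡ true)
  common-edges u v = mk⇔
    (λ uv i → map (e i) u , map (e i) v , α-image i u , α-image i v , Embedding.preserves (e i) uv) from
    where
    from : (∀ i → ∃ λ a → ∃ λ b → α i a ≡ φ u × α i b ≡ φ v × adj G a b ≡ true) → E u v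
    from edge-everywhere with E? u v
    ... | yes uv = uv
    ... | no ¬uv with separating u v ¬uv
    ...   | i , non-edge with edge-everywhere i
    ...     | a , b , αa≡φu , αb≡φv , ab
            rewrite α≡φ⇒image i a u αa≡φu | α≡φ⇒image i b v αb≡φv
            with () ← trans (sym non-edge) ab

  intersectsTo : IntersectsTo G V E
  intersectsTo = 2 + k , s≤s z≤n , α , α-injective , φ , φ-injective , common-labels , common-edges

-- The forest tS_{t,t,t}

module _ {t : ℕ} where

  copyOf : tSttt-V t → Fin t
  copyOf = proj₁

  -- The centre is given leg 0; it is told apart from leg vertices by its depth 0.
  legOf : tSttt-V t → Fin 3
  legOf (_ , nothing) = zero
  legOf (_ , just (l , _)) = l

  depth : tSttt-V t → ℕ
  depth (_ , nothing) = 0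
  depth (_ , just (_ , i)) = suc (toℕ i)

  coordinates-injective : ∀ {u v} → copyOf u ≡ copyOf v → depth u ≡ depth v →
                          depth u ≡ 0 ⊎ legOf u ≡ legOf v → u ≡ v
  coordinates-injective {_ , nothing} {_ , nothing} refl _ _ = refl
  coordinates-injective {_ , just _} {_ , just _} refl du≡dv (inj₂ refl) =
    cong (λ i → _ , just (_ , i)) (toℕ-injective (ℕ.suc-injective du≡dv))

  ArcShape : tSttt-V t → tSttt-V t → Set
  ArcShape u v = copyOf u ≡ copyOf v × depth v ≡ suc (depth u) × (depth u ≡ 0 ⊎ legOf u ≡ legOf v)

  arc-shape : ∀ {u v} → tSttt-Arc t u v → ArcShape u v
  arc-shape (hub _ _ _ i≡0) = refl , cong suc i≡0 , inj₁ refl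
  arc-shape (leg _ _ _ _ j≡1+i) = refl , cong suc j≡1+i , inj₂ refl

  shape-arc : ∀ {u v} → ArcShape u v → tSttt-Arc t u v
  shape-arc {_ , nothing} {_ , just (l , i)} (refl , dv≡1 , _) = hub _ l i (ℕ.suc-injective dv≡1)
  shape-arc {_ , just (l , i)} {_ , just (_ , j)} (refl , dv≡1+du , inj₂ refl) = leg _ l i j (ℕ.suc-injective dv≡1+du)

  arc-depth : ∀ {u v} → tSttt-Arc t u v → depth v ≡ suc (depth u)
  arc-depth = proj₁ ∘ proj₂ ∘ arc-shape

  arc-irreflexive : ∀ {v} → ¬ tSttt-Arc t v v
  arc-irreflexive arc = ℕ.1+n≢n (sym (arc-depth arc))

  arc? : ∀ u v → Dec (tSttt-Arc t u v)
  arc? u v = Dec.map′ shape-arc arc-shape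
    (copyOf u ≟ copyOf v ×-dec depth v ℕ.≟ suc (depth u) ×-dec (depth u ℕ.≟ 0 ⊎-dec legOf u ≟ legOf v))

  edge? : ∀ u v → Dec (tSttt-E t u v)
  edge? u v = arc? u v ⊎-dec arc? v u

  code : tSttt-V t → Fin (t * suc (3 * t))
  code (c , nothing) = combine c zero
  code (c , just (l , i)) = combine c (suc (combine l i))

  decode : Fin (t * suc (3 * t)) → tSttt-V t
  decode f with remQuot (suc (3 * t)) f
  ... | c , zero = c , nothing
  ... | c , suc r = c , just (remQuot t r)

  decode-code : ∀ v → decode (code v) ≡ v
  decode-code (c , nothing) rewrite remQuot-combine {k = suc (3 * t)} c zero = refl
  decode-code (c , just (l , i))
    rewrite remQuot-combine {k = suc (3 * t)} c (suc (combine l i)) | remQuot-combine {k = t} l i = refl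

  code-injective : Injective _≡_ _≡_ code
  code-injective {u} {v} eq = trans (sym (decode-code u)) (trans (cong decode eq) (decode-code v))

  OnLine : Fin t → Fin 3 → tSttt-V t → Set
  OnLine c l v = copyOf v ≡ c × (depth v ≡ 0 ⊎ legOf v ≡ l)

  on-line? : ∀ c l v → Dec (OnLine c l v)
  on-line? c l v = copyOf v ≟ c ×-dec (depth v ℕ.≟ 0 ⊎-dec legOf v ≟ l)

  on-line-injective : ∀ {c l u v} → OnLine c l u → OnLine c l v → depth u ≡ depth v → u ≡ v
  on-line-injective (refl , inj₁ du≡0) (cv≡c , _) du≡dv =
    coordinates-injective (sym cv≡c) du≡dv (inj₁ du≡0)
  on-line-injective (refl , inj₂ refl) (cv≡c , inj₂ lv≡l) du≡dv =
    coordinates-injective (sym cv≡c) du≡dv (inj₂ (sym lv≡l))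
  on-line-injective (refl , inj₂ _) (cv≡c , inj₁ dv≡0) du≡dv =
    coordinates-injective (sym cv≡c) du≡dv (inj₁ (trans du≡dv dv≡0))

  on-line-arc : ∀ {c l u v} → OnLine c l u → OnLine c l v → depth v ≡ suc (depth u) → tSttt-Arc t u v
  on-line-arc (refl , inj₁ du≡0) (refl , _) dv≡1+du = shape-arc (refl , dv≡1+du , inj₁ du≡0)
  on-line-arc (refl , inj₂ refl) (refl , inj₂ lv≡l) dv≡1+du = shape-arc (refl , dv≡1+du , inj₂ (sym lv≡l))
  on-line-arc (refl , inj₂ _) (refl , inj₁ dv≡0) dv≡1+du = contradiction (trans (sym dv≡1+du) dv≡0) ℕ.1+n≢0

  arc-on-line-source : ∀ {c l u v} → tSttt-Arc t u v → OnLine c l v → OnLine c l u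
  arc-on-line-source arc (refl , v-on) with arc-shape arc
  ... | refl , dv≡1+du , inj₁ du≡0 = refl , inj₁ du≡0
  ... | refl , dv≡1+du , inj₂ lu≡lv with v-on
  ...   | inj₁ dv≡0 = contradiction (trans (sym dv≡1+du) dv≡0) ℕ.1+n≢0
  ...   | inj₂ lv≡l = refl , inj₂ (trans lu≡lv lv≡l)

  arc-on-line-target : ∀ {c l u v} → tSttt-Arc t u v → OnLine c l u → depth u ≡ 0 ⊎ OnLine c l v
  arc-on-line-target arc (refl , u-on) with arc-shape arc
  ... | refl , _ , inj₁ du≡0 = inj₁ du≡0
  ... | refl , _ , inj₂ lu≡lv with u-on
  ...   | inj₁ du≡0 = inj₁ du≡0
  ...   | inj₂ lu≡l = inj₂ (refl , inj₂ (trans (sym lu≡lv) lu≡l))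

  parent : Fin t → Fin 3 → Fin t → tSttt-V t
  parent c l zero = c , nothing
  parent c l (suc i) = c , just (l , inject₁ i)

  parent-arc : ∀ c l i → tSttt-Arc t (parent c l i) (c , just (l , i))
  parent-arc c l zero = hub c l zero refl
  parent-arc c l (suc i) = leg c l (inject₁ i) (suc i) (cong suc (sym (toℕ-inject₁ i)))

first : ∀ {t} → Fin t → Fin t
first {suc _} _ = zero

toℕ-first : ∀ {t} (c : Fin t) → toℕ (first c) ≡ 0
toℕ-first {suc _} _ = refl

-- Embedding tS_{t,t,t} into H

module _ (H : Graph) (A T : Subset (n H)) where

  record Filler (V : Set) : Set where
    field
      fill : ∀ {x p v : V} → x ≢ p → x ≢ v → p ≢ v → Fin (n H)
      fill-injective : ∀ {x p u v : V} {x≢p : x ≢ p}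
                         {x≢u : x ≢ u} {p≢u : p ≢ u} {x≢v : x ≢ v} {p≢v : p ≢ v} →
                       fill x≢p x≢u p≢u ≡ fill x≢p x≢v p≢v → u ≡ v
      fill-∈A : ∀ {x p v : V} (x≢p : x ≢ p) (x≢v : x ≢ v) (p≢v : p ≢ v) → fill x≢p x≢v p≢v ∈ A
      fill-∉T : ∀ {x p v : V} (x≢p : x ≢ p) (x≢v : x ≢ v) (p≢v : p ≢ v) → fill x≢p x≢v p≢v ∉ T

  filler : ∀ {V m} (code : V → Fin (suc (suc m))) → Injective _≡_ _≡_ code → m ≤ ∣ A ∩ ∁ T ∣ → Filler V
  filler code code-injective m≤∣A∖T∣ with enumerate (A ∩ ∁ T) m≤∣A∖T∣
  ... | a , a-injective , a∈A∖T = record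
    { fill = λ x≢p x≢v p≢v → a (punchOut₂ (≢code x≢p) (≢code x≢v) (≢code p≢v))
    ; fill-injective = λ {_ _ _ _ x≢p x≢u p≢u x≢v p≢v} eq → code-injective
        (punchOut₂-injective (≢code x≢p) (≢code x≢u) (≢code p≢u) (≢code x≢v) (≢code p≢v) (a-injective eq))
    ; fill-∈A = λ _ _ _ → proj₁ (x∈p∩q⁻ A (∁ T) (a∈A∖T _))
    ; fill-∉T = λ _ _ _ → x∈∁p⇒x∉p (proj₂ (x∈p∩q⁻ A (∁ T) (a∈A∖T _)))
    }
    where
    ≢code : ∀ {u v} → u ≢ v → code u ≢ code v
    ≢code u≢v = u≢v ∘ code-injective

  record Spider : Set where
    field
      centre : Fin (n H)
      centre∉A : centre ∉ A
      length : Fin 3 → ℕ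
      ray : Fin 3 → ℕ → Fin (n H)
      ray-start : ∀ l → ray l 0 ≡ centre
      length-positive : ∀ l → 1 ≤ length l
      ray-adjacent : ∀ l {j} → j < length l → adj H (ray l j) (ray l (suc j)) ≡ true
      ray-end∈A : ∀ l → ray l (length l) ∈ A
      ray-∈T : ∀ l j → ray l j ∈ T
      ray-injective : ∀ {l l′ i j} → i ≤ length l → j ≤ length l′ → ray l i ≡ ray l′ j →
                      (l ≡ l′ × i ≡ j) ⊎ (i ≡ 0 × j ≡ 0)

  record SeparatingPath : Set where
    field
      length : ℕ
      vertex : ℕ → Fin (n H)
      length-positive : 1 ≤ length
      start∈A : vertex 0 ∈ A
      end∈A : vertex length ∈ A
      adjacent : ∀ {j} → j < length → adj H (vertex j) (vertex (suc j)) ≡ true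
      ∈T : ∀ j → vertex j ∈ T
      injective : ∀ {i j} → i ≤ length → j ≤ length → vertex i ≡ vertex j → i ≡ j
      second∉A : vertex 1 ∉ A
      second-isolated : ∀ {j} → 3 ≤ j → j ≤ length → adj H (vertex 1) (vertex j) ≡ false

module _ {H : Graph} {A T : Subset (n H)} where

  spider : ∀ {w} {y : Fin 3 → Fin (n H)} {Q : Fin 3 → List (Fin (n H))} →
           (∀ l → IsPath H w (y l) (Q l)) →
           (∀ {l l′} → l ≢ l′ → ∀ {v} → v ∈ₗ Q l → v ∈ₗ Q l′ → v ≡ w) →
           (∀ l {v} → v ∈ₗ Q l → v ∈ T) → (∀ l → y l ∈ A) → (∀ l → y l ≢ w) → w ∉ A →
           Spider H A T
  spider {w} {y} {Q} path Q-meet Q⊆T y∈A y≢w w∉A = record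
    { centre = w
    ; centre∉A = w∉A
    ; length = λ l → len (walk l)
    ; ray = λ l j → walk l ‼ j
    ; ray-start = λ l → ‼-zero (walk l)
    ; length-positive = λ l → len-positive (walk l) (y≢w l ∘ sym)
    ; ray-adjacent = λ l → ‼-adjacent (walk l)
    ; ray-end∈A = λ l → subst (_∈ A) (sym (‼-len (walk l))) (y∈A l)
    ; ray-∈T = λ l j → Q⊆T l (‼-∈ (walk l) j)
    ; ray-injective = ray-injective
    }
    where
    walk : ∀ l → WalkList H w (y l) (Q l)
    walk l = proj₁ (path l)

    at-centre : ∀ l {i} → i ≤ len (walk l) → walk l ‼ i ≡ w → i ≡ 0
    at-centre l i≤len eq = ‼-injective (walk l) (proj₂ (path l)) i≤len z≤n (trans eq (sym (‼-zero (walk l))))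

    ray-injective : ∀ {l l′ i j} → i ≤ len (walk l) → j ≤ len (walk l′) → walk l ‼ i ≡ walk l′ ‼ j →
                    (l ≡ l′ × i ≡ j) ⊎ (i ≡ 0 × j ≡ 0)
    ray-injective {l} {l′} {i} {j} i≤len j≤len eq with l ≟ l′
    ... | yes refl = inj₁ (refl , ‼-injective (walk l) (proj₂ (path l)) i≤len j≤len eq)
    ... | no l≢l′ = inj₂ (at-centre l i≤len ray≡w , at-centre l′ j≤len (trans (sym eq) ray≡w))
      where
      ray≡w : walk l ‼ i ≡ w
      ray≡w = Q-meet l≢l′ (‼-∈ (walk l) i) (subst (_∈ₗ Q l′) (sym eq) (‼-∈ (walk l′) j))

  -- The cycle Q₁ ∪ Q₂ read from y₁ back to w and on to y₂.
  separating-path : ∀ {w y₁ y₂ Q₁ Q₂} → IsPath H w y₁ Q₁ → IsPath H w y₂ Q₂ →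
    InducesCycle H (λ v → v ∈ₗ Q₁ ⊎ v ∈ₗ Q₂) →
    (∀ {v} → v ∈ₗ Q₁ → v ∈ₗ Q₂ → v ≡ w) →
    (∀ {v} → v ∈ₗ Q₁ ⊎ v ∈ₗ Q₂ → v ∈ T) →
    (∀ {v} → v ∈ₗ Q₁ ⊎ v ∈ₗ Q₂ → v ∈ A → v ≡ y₁ ⊎ v ≡ y₂) →
    y₁ ∈ A → y₂ ∈ A → y₁ ≢ w → y₂ ≢ w → SeparatingPath H A T
  separating-path _ (single _ , _) _ _ _ _ _ _ _ y₂≢w = contradiction refl y₂≢w
  separating-path {w} {y₁} {y₂} {Q₁} (W₁ , Q₁-unique) (step {xs = ys} e W₂ , w∉ys ∷ ys-unique)
                  cycle Q-meet Q⊆T Q∩A y₁∈A y₂∈A y₁≢w y₂≢w = record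
    { length = L
    ; vertex = σ ‼_
    ; length-positive = 1≤L
    ; start∈A = subst (_∈ A) (sym (‼-zero σ)) y₁∈A
    ; end∈A = subst (_∈ A) (sym (‼-len σ)) y₂∈A
    ; adjacent = ‼-adjacent σ
    ; ∈T = λ j → Q⊆T (on-cycle (‼-∈ σ j))
    ; injective = ‼-injective σ σ-unique
    ; second∉A = second∉A
    ; second-isolated = second-isolated
    }
    where
    σ : WalkList H y₁ y₂ (reverse Q₁ ++ ys)
    σ = join (reverseʷ W₁) e W₂

    L : ℕ
    L = len σ

    on-cycle : ∀ {v} → v ∈ₗ reverse Q₁ ++ ys → v ∈ₗ Q₁ ⊎ v ∈ₗ w ∷ ys
    on-cycle v∈σ with ∈-++⁻ (reverse Q₁) v∈σ
    ... | inj₁ v∈Q₁ = inj₁ (Any.reverse⁻ v∈Q₁)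
    ... | inj₂ v∈ys = inj₂ (there v∈ys)

    σ-unique : Unique (reverse Q₁ ++ ys)
    σ-unique = ++⁺ (Unique-reverse Q₁-unique) ys-unique disjoint
      where
      disjoint : ∀ {v} → ¬ (v ∈ₗ reverse Q₁ × v ∈ₗ ys)
      disjoint (v∈Q₁ , v∈ys) with Q-meet (Any.reverse⁻ v∈Q₁) (there v∈ys)
      ... | refl = All.lookup w∉ys v∈ys refl

    σ-injective : ∀ {i j} → i ≤ L → j ≤ L → σ ‼ i ≡ σ ‼ j → i ≡ j
    σ-injective = ‼-injective σ σ-unique

    -- w lies strictly inside σ.
    2≤L : 2 ≤ L
    2≤L with ‼-surjective σ (∈-++⁺ˡ (Any.reverse⁺ (subst (_∈ₗ Q₁) (‼-zero W₁) (‼-∈ W₁ 0))))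
    ... | zero , _ , σ₀≡w = contradiction (trans (sym (‼-zero σ)) σ₀≡w) y₁≢w
    ... | suc j , j<L , σⱼ≡w = ℕ.≤-trans (s≤s (s≤s z≤n)) (ℕ.≤∧≢⇒< j<L λ j≡L →
            y₂≢w (trans (sym (‼-len σ)) (subst (λ k → σ ‼ k ≡ w) j≡L σⱼ≡w)))

    1≤L : 1 ≤ L
    1≤L = ℕ.≤-trans (s≤s z≤n) 2≤L

    second∉A : σ ‼ 1 ∉ A
    second∉A σ₁∈A with Q∩A (on-cycle (‼-∈ σ 1)) σ₁∈A
    ... | inj₁ σ₁≡y₁ = ℕ.1+n≢0 (σ-injective 1≤L z≤n (trans σ₁≡y₁ (sym (‼-zero σ))))
    ... | inj₂ σ₁≡y₂ = ℕ.<⇒≢ 2≤L (σ-injective 1≤L ℕ.≤-refl (trans σ₁≡y₂ (sym (‼-len σ))))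

    second-isolated : ∀ {j} → 3 ≤ j → j ≤ L → adj H (σ ‼ 1) (σ ‼ j) ≡ false
    second-isolated {j} 3≤j j≤L = ¬-not λ σ₁σⱼ →
      induced-cycle-¬three-neighbours {H} cycle (on 1) (on 0) (on 2) (on j)
        (λ eq → ℕ.0≢1+n (σ-injective z≤n 2≤L eq))
        (λ eq → ℕ.<⇒≢ (ℕ.≤-trans (s≤s z≤n) 3≤j) (σ-injective z≤n j≤L eq))
        (λ eq → ℕ.<⇒≢ 3≤j (σ-injective 2≤L j≤L eq))
        (trans (Graph.sym H _ _) (‼-adjacent σ 1≤L))
        (‼-adjacent σ 2≤L)
        σ₁σⱼ
      where
      on : ∀ k → σ ‼ k ∈ₗ Q₁ ⊎ σ ‼ k ∈ₗ w ∷ ys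
      on k = on-cycle (‼-∈ σ k)

module Embeddings (H : Graph) (A T : Subset (n H))
  (clique : ∀ u v → u ∈ A → v ∈ A → u ≢ v → adj H u v ≡ true)
  (anti : ∀ u v → u ∈ A → u ∉ T → v ∈ T → v ∉ A → adj H u v ≡ false) where

  -- A map r on the part P of V, landing in T, is extended to all of V by filling
  -- the rest into A ∖ T.  The extension preserves R as soon as r does inside P
  -- and r sends every vertex on the border of P into A: all other new adjacencies
  -- then lie inside the clique A.
  module Extension {V : Set} {R : V → V → Set} (R-irreflexive : ∀ {v} → ¬ R v v)
    {P : V → Set} (P? : ∀ v → Dec (P v)) (r : V → Fin (n H))
    (r-injective : ∀ {u v} → P u → P v → r u ≡ r v → u ≡ v)
    (r-∈T : ∀ {v} → P v → r v ∈ T)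
    (r-preserves : ∀ {u v} → R u v → P u → P v → adj H (r u) (r v) ≡ true)
    (r-border : ∀ {u v} → R u v ⊎ R v u → P u → ¬ P v → r u ∈ A)
    (F : Filler H A T V) {x p : V} (x≢p : x ≢ p) (x∈P : P x) (p∈P : P p) where

    open Filler F

    private
      outside≢ : ∀ {y v} → P y → ¬ P v → y ≢ v
      outside≢ y∈P v∉P refl = v∉P y∈P

      f : ∀ v → ¬ P v → Fin (n H)
      f v v∉P = fill x≢p (outside≢ x∈P v∉P) (outside≢ p∈P v∉P)

      f-∈A : ∀ v v∉P → f v v∉P ∈ A
      f-∈A v v∉P = fill-∈A x≢p (outside≢ x∈P v∉P) (outside≢ p∈P v∉P)

      f-∉T : ∀ v v∉P → f v v∉P ∉ T
      f-∉T v v∉P = fill-∉T x≢p (outside≢ x∈P v∉P) (outside≢ p∈P v∉P)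

      r≢f : ∀ {u v} u∈P v∉P → r u ≢ f v v∉P
      r≢f {v = v} u∈P v∉P eq = f-∉T v v∉P (subst (_∈ T) eq (r-∈T u∈P))

    extend : V → Fin (n H)
    extend v with P? v
    ... | yes _ = r v
    ... | no v∉P = f v v∉P

    extend-inside : ∀ {v} → P v → extend v ≡ r v
    extend-inside {v} v∈P with P? v
    ... | yes _ = refl
    ... | no v∉P = contradiction v∈P v∉P

    extend-outside : ∀ {v} → ¬ P v → extend v ∈ A × extend v ∉ T
    extend-outside {v} v∉P with P? v
    ... | yes v∈P = contradiction v∈P v∉P
    ... | no v∉P = f-∈A v v∉P , f-∉T v v∉P

    extend-injective : Injective _≡_ _≡_ extend
    extend-injective {u} {v} eq with P? u | P? v
    ... | yes u∈P | yes v∈P = r-injective u∈P v∈P eq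
    ... | yes u∈P | no v∉P = contradiction eq (r≢f u∈P v∉P)
    ... | no u∉P | yes v∈P = contradiction (sym eq) (r≢f v∈P u∉P)
    ... | no u∉P | no v∉P = fill-injective eq

    extend-preserves : ∀ {u v} → R u v → adj H (extend u) (extend v) ≡ true
    extend-preserves {u} {v} uv with P? u | P? v
    ... | yes u∈P | yes v∈P = r-preserves uv u∈P v∈P
    ... | yes u∈P | no v∉P = clique _ _ (r-border (inj₁ uv) u∈P v∉P) (f-∈A v v∉P) (r≢f u∈P v∉P)
    ... | no u∉P | yes v∈P = clique _ _ (f-∈A u u∉P) (r-border (inj₂ uv) v∈P u∉P) (r≢f v∈P u∉P ∘ sym)
    ... | no u∉P | no v∉P = clique _ _ (f-∈A u u∉P) (f-∈A v v∉P)
                              (λ eq → R-irreflexive (subst (R u) (sym (fill-injective eq)) uv))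

    embedding : Embedding H R
    embedding = record { map = extend ; injective = extend-injective ; preserves = extend-preserves }

  -- Copy c is laid onto the spider, centre on centre, as far as the rays reach.
  module CentreEmbedding (S : Spider H A T) {t} (F : Filler H A T (tSttt-V t)) (c : Fin t) where

    open Spider S

    Reached : tSttt-V t → Set
    Reached v = copyOf v ≡ c × depth v ≤ length (legOf v)

    place : tSttt-V t → Fin (n H)
    place v = ray (legOf v) (depth v)

    private
      centre-reached : Reached (c , nothing)
      centre-reached = refl , z≤n

      child : tSttt-V t
      child = c , just (zero , first c)

      child-reached : Reached child
      child-reached = refl , subst (λ d → suc d ≤ length zero) (sym (toℕ-first c)) (length-positive zero)

      place-injective : ∀ {u v} → Reached u → Reached v → place u ≡ place v → u ≡ v
      place-injective (refl , du≤) (cv≡c , dv≤) eq with ray-injective du≤ dv≤ eq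
      ... | inj₁ (lu≡lv , du≡dv) = coordinates-injective (sym cv≡c) du≡dv (inj₂ lu≡lv)
      ... | inj₂ (du≡0 , dv≡0) = coordinates-injective (sym cv≡c) (trans du≡0 (sym dv≡0)) (inj₁ du≡0)

      -- When u is the centre, all rays start there.
      arc-place : ∀ {u v} → tSttt-Arc t u v → place u ≡ ray (legOf v) (depth u)
      arc-place arc with arc-shape arc
      ... | _ , _ , inj₁ du≡0 rewrite du≡0 = trans (ray-start _) (sym (ray-start _))
      ... | _ , _ , inj₂ lu≡lv = cong (λ l → ray l _) lu≡lv

      place-preserves : ∀ {u v} → tSttt-Arc t u v → Reached u → Reached v → adj H (place u) (place v) ≡ true
      place-preserves arc _ (_ , dv≤) with arc-shape arc
      ... | _ , dv≡1+du , _ rewrite arc-place arc | dv≡1+du = ray-adjacent _ dv≤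

      place-border : ∀ {u v} → tSttt-Arc t u v ⊎ tSttt-Arc t v u → Reached u → ¬ Reached v → place u ∈ A
      place-border {u} {v} (inj₁ arc) (refl , du≤) v∉R with arc-shape arc
      ... | refl , dv≡1+du , inj₁ du≡0 = contradiction (refl , 1≥dv) v∉R
        where
        1≥dv = subst (_≤ length (legOf v)) (sym (trans dv≡1+du (cong suc du≡0))) (length-positive (legOf v))
      ... | refl , dv≡1+du , inj₂ lu≡lv = subst (λ d → ray (legOf u) d ∈ A) (sym du≡length) (ray-end∈A (legOf u))
        where
        length<dv : length (legOf u) < depth v
        length<dv = subst (λ l → length l < depth v) (sym lu≡lv) (ℕ.≰⇒> λ dv≤ → v∉R (refl , dv≤))
        du≡length : depth u ≡ length (legOf u)
        du≡length = ℕ.≤-antisym du≤ (s≤s⁻¹ (subst (length (legOf u) <_) dv≡1+du length<dv))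
      place-border {u} {v} (inj₂ arc) (refl , du≤) v∉R with arc-shape arc
      ... | refl , _ , inj₁ dv≡0 = contradiction (refl , subst (_≤ length (legOf v)) (sym dv≡0) z≤n) v∉R
      ... | refl , du≡1+dv , inj₂ lv≡lu =
            contradiction (refl , ℕ.≤-trans (ℕ.n≤1+n _) (subst₂ (λ d l → d ≤ length l) du≡1+dv (sym lv≡lu) du≤))
                          v∉R

    open Extension arc-irreflexive (λ v → copyOf v ≟ c ×-dec depth v ≤? length (legOf v)) place
      place-injective (λ _ → ray-∈T _ _) place-preserves place-border F (λ ()) centre-reached child-reached public

    extend-centre : extend (c , nothing) ≡ centre
    extend-centre = trans (extend-inside centre-reached) (ray-start zero)

    separates-centres : ∀ {c′} → c′ ≢ c → adj H (extend (c , nothing)) (extend (c′ , nothing)) ≡ false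
    separates-centres c′≢c with extend-outside (c′≢c ∘ proj₁)
    ... | ∈A , ∉T rewrite extend-centre =
      trans (Graph.sym H _ _) (anti _ _ ∈A ∉T (subst (_∈ T) (ray-start zero) (ray-∈T zero 0)) centre∉A)

  module LegEmbedding (σ : SeparatingPath H A T) {t} (F : Filler H A T (tSttt-V t))
                      (c : Fin t) (l : Fin 3) (i : Fin t) where

    open SeparatingPath σ

    x : tSttt-V t
    x = c , just (l , i)

    private
      n₀ : ℕ
      n₀ = toℕ i

    Reached : tSttt-V t → Set
    Reached v = OnLine c l v × n₀ ≤ depth v × depth v ∸ n₀ ≤ length

    place : tSttt-V t → Fin (n H)
    place v = vertex (depth v ∸ n₀)

    private
      offset-suc : ∀ {d} → n₀ ≤ d → suc d ∸ n₀ ≡ suc (d ∸ n₀)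
      offset-suc = ℕ.+-∸-assoc 1

      x-on-line : OnLine c l x
      x-on-line = refl , inj₂ refl

      x-offset : depth x ∸ n₀ ≡ 1
      x-offset = ℕ.m+n∸n≡m 1 n₀

      x-reached : Reached x
      x-reached = x-on-line , ℕ.n≤1+n n₀ , subst (_≤ length) (sym x-offset) length-positive

      p : tSttt-V t
      p = parent c l i

      p-depth : depth p ≡ n₀
      p-depth = ℕ.suc-injective (sym (arc-depth (parent-arc c l i)))

      p-reached : Reached p
      p-reached = arc-on-line-source (parent-arc c l i) x-on-line
                , subst (n₀ ≤_) (sym p-depth) ℕ.≤-refl
                , subst (λ d → d ∸ n₀ ≤ length) (sym p-depth)
                        (subst (_≤ length) (sym (ℕ.n∸n≡0 n₀)) z≤n)

      x≢p : x ≢ p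
      x≢p x≡p = ℕ.1+n≢n (trans (cong depth x≡p) p-depth)

      place-injective : ∀ {u v} → Reached u → Reached v → place u ≡ place v → u ≡ v
      place-injective (u-on , n₀≤du , ou≤) (v-on , n₀≤dv , ov≤) eq =
        on-line-injective u-on v-on (ℕ.∸-cancelʳ-≡ n₀≤du n₀≤dv (injective ou≤ ov≤ eq))

      place-preserves : ∀ {u v} → tSttt-Arc t u v → Reached u → Reached v → adj H (place u) (place v) ≡ true
      place-preserves arc (_ , n₀≤du , _) (_ , _ , ov≤) with arc-shape arc
      ... | _ , dv≡1+du , _ rewrite dv≡1+du | offset-suc n₀≤du = adjacent ov≤

      place-end : ∀ {u} → depth u ∸ n₀ ≡ 0 ⊎ depth u ∸ n₀ ≡ length → place u ∈ A
      place-end (inj₁ ou≡0) = subst (λ j → vertex j ∈ A) (sym ou≡0) start∈A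
      place-end (inj₂ ou≡length) = subst (λ j → vertex j ∈ A) (sym ou≡length) end∈A

      place-border : ∀ {u v} → tSttt-Arc t u v ⊎ tSttt-Arc t v u → Reached u → ¬ Reached v → place u ∈ A
      place-border {u} {v} (inj₁ arc) (u-on , n₀≤du , ou≤) v∉R with arc-on-line-target arc u-on
      ... | inj₁ du≡0 = place-end (inj₁ (ℕ.m≤n⇒m∸n≡0 (subst (_≤ n₀) (sym du≡0) z≤n)))
      ... | inj₂ v-on = place-end (inj₂ (ℕ.≤-antisym ou≤ (s≤s⁻¹ length<1+ou)))
        where
        dv≡1+du : depth v ≡ suc (depth u)
        dv≡1+du = arc-depth arc
        n₀≤dv : n₀ ≤ depth v
        n₀≤dv = subst (n₀ ≤_) (sym dv≡1+du) (ℕ.m≤n⇒m≤1+n n₀≤du)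
        length<1+ou : length < suc (depth u ∸ n₀)
        length<1+ou = subst (length <_) (trans (cong (_∸ n₀) dv≡1+du) (offset-suc n₀≤du))
                        (ℕ.≰⇒> λ ov≤ → v∉R (v-on , n₀≤dv , ov≤))
      place-border {u} {v} (inj₂ arc) (u-on , n₀≤du , ou≤) v∉R with n₀ ≤? depth v
      ... | yes n₀≤dv = contradiction (arc-on-line-source arc u-on , n₀≤dv , ℕ.≤-trans ov≤ou ou≤) v∉R
        where
        ov≤ou : depth v ∸ n₀ ≤ depth u ∸ n₀
        ov≤ou = ℕ.∸-monoˡ-≤ n₀ (subst (depth v ≤_) (sym (arc-depth arc)) (ℕ.n≤1+n _))
      ... | no n₀≰dv =
            place-end (inj₁ (ℕ.m≤n⇒m∸n≡0 (subst (_≤ n₀) (sym (arc-depth arc)) (ℕ.≰⇒> n₀≰dv))))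

    reached? : ∀ v → Dec (Reached v)
    reached? v = on-line? c l v ×-dec n₀ ≤? depth v ×-dec depth v ∸ n₀ ≤? length

    open Extension arc-irreflexive reached?
      place place-injective (λ _ → ∈T _) place-preserves place-border F x≢p x-reached p-reached public

    extend-x : extend x ≡ vertex 1
    extend-x = trans (extend-inside x-reached) (cong vertex x-offset)

    separates : ∀ v → ¬ tSttt-E t x v → adj H (extend x) (extend v) ≡ false
    separates v ¬xv rewrite extend-x = by-cases (reached? v)
      where
      by-offset : OnLine c l v → ∀ j → depth v ≡ j + n₀ → j ≤ length → adj H (vertex 1) (vertex j) ≡ false
      by-offset v-on 0 dv≡n₀ _ = contradiction (inj₂ (on-line-arc v-on x-on-line (cong suc (sym dv≡n₀)))) ¬xv
      by-offset v-on 1 _ _ = irrefl H (vertex 1)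
      by-offset v-on 2 dv≡2+n₀ _ = contradiction (inj₁ (on-line-arc x-on-line v-on dv≡2+n₀)) ¬xv
      by-offset v-on (suc (suc (suc j))) _ j≤length = second-isolated (s≤s (s≤s (s≤s z≤n))) j≤length

      by-cases : Dec (Reached v) → adj H (vertex 1) (extend v) ≡ false
      by-cases (yes v∈R@(v-on , n₀≤dv , ov≤)) rewrite extend-inside v∈R =
        by-offset v-on (depth v ∸ n₀) (sym (ℕ.m∸n+n≡m n₀≤dv)) ov≤
      by-cases (no v∉R) = let ∈A , ∉T = extend-outside v∉R in
        trans (Graph.sym H _ _) (anti _ _ ∈A ∉T (∈T 1) second∉A)

  representation : ∀ t → Spider H A T → SeparatingPath H A T → Filler H A T (tSttt-V (suc t)) →
                   IntersectsTo H (tSttt-V (suc t)) (tSttt-E (suc t))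
  representation t S σ F =
    FromSeparatingEmbeddings.intersectsTo H (tSttt-E (suc t)) edge? code decode decode-code
      (embedding ∘ decode) separating-indexed
    where
    embedding : tSttt-V (suc t) → Embedding H (tSttt-E (suc t))
    embedding (c , nothing) = symmetrise (CentreEmbedding.embedding S F c)
    embedding (c , just (l , i)) = symmetrise (LegEmbedding.embedding σ F c l i)

    separating : ∀ u v → ¬ tSttt-E (suc t) u v →
                 ∃ λ x → adj H (map (embedding x) u) (map (embedding x) v) ≡ false
    separating u@(c , just (l , i)) v ¬uv = u , LegEmbedding.separates σ F c l i v ¬uv
    separating u v@(c , just (l , i)) ¬uv =
      v , trans (Graph.sym H _ _) (LegEmbedding.separates σ F c l i u (¬uv ∘ Data.Sum.swap))
    separating (c , nothing) (c′ , nothing) ¬uv with c′ ≟ c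
    ... | yes refl = (c , nothing) , irrefl H _
    ... | no c′≢c = (c , nothing) , CentreEmbedding.separates-centres S F c c′≢c

    separating-indexed : ∀ u v → ¬ tSttt-E (suc t) u v →
                         ∃ λ i → adj H (map (embedding (decode i)) u) (map (embedding (decode i)) v) ≡ false
    separating-indexed u v ¬uv with separating u v ¬uv
    ... | x , x-separates = code x , subst (λ y → adj H (map (embedding y) u) (map (embedding y) v) ≡ false)
                                           (sym (decode-code x)) x-separates

module Configuration {H : Graph} {A T : Subset (n H)} {w y₁ y₂ y₃ : Fin (n H)}
  {Q₁ Q₂ Q₃ : List (Fin (n H))}
  (T⇔ : ∀ v → v ∈ T ⇔ (v ∈ₗ Q₁ ⊎ v ∈ₗ Q₂ ⊎ v ∈ₗ Q₃))
  (P₁ : IsPath H w y₁ Q₁) (P₂ : IsPath H w y₂ Q₂) (P₃ : IsPath H w y₃ Q₃)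
  (y₁∈A : y₁ ∈ A) (y₂∈A : y₂ ∈ A) (y₃∈A : y₃ ∈ A)
  (Q₁Q₂ : ∀ v → v ≢ w → ¬ (v ∈ₗ Q₁ × v ∈ₗ Q₂))
  (Q₁Q₃ : ∀ v → v ≢ w → ¬ (v ∈ₗ Q₁ × v ∈ₗ Q₃))
  (Q₂Q₃ : ∀ v → v ≢ w → ¬ (v ∈ₗ Q₂ × v ∈ₗ Q₃))
  (A∩T⇔ : ∀ v → v ∈ A ∩ T ⇔ (v ≡ y₁ ⊎ v ≡ y₂ ⊎ v ≡ y₃))
  (y₁≢w : y₁ ≢ w) (y₂≢w : y₂ ≢ w) (y₃≢w : y₃ ≢ w) where

  Q : Fin 3 → List (Fin (n H))
  Q 0F = Q₁
  Q 1F = Q₂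
  Q 2F = Q₃

  y : Fin 3 → Fin (n H)
  y 0F = y₁
  y 1F = y₂
  y 2F = y₃

  path : ∀ l → IsPath H w (y l) (Q l)
  path 0F = P₁
  path 1F = P₂
  path 2F = P₃

  y∈A : ∀ l → y l ∈ A
  y∈A 0F = y₁∈A
  y∈A 1F = y₂∈A
  y∈A 2F = y₃∈A

  y≢w : ∀ l → y l ≢ w
  y≢w 0F = y₁≢w
  y≢w 1F = y₂≢w
  y≢w 2F = y₃≢w

  Q⊆T : ∀ l {v} → v ∈ₗ Q l → v ∈ T
  Q⊆T 0F v∈Q = Equivalence.from (T⇔ _) (inj₁ v∈Q)
  Q⊆T 1F v∈Q = Equivalence.from (T⇔ _) (inj₂ (inj₁ v∈Q))
  Q⊆T 2F v∈Q = Equivalence.from (T⇔ _) (inj₂ (inj₂ v∈Q))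

  Q-meet : ∀ {l l′} → l ≢ l′ → ∀ {v} → v ∈ₗ Q l → v ∈ₗ Q l′ → v ≡ w
  Q-meet {l} {l′} l≢l′ {v} v∈Qₗ v∈Qₗ′ with v ≟ w
  ... | yes v≡w = v≡w
  ... | no v≢w = contradiction (v∈Qₗ , v∈Qₗ′) (apart l l′ l≢l′ v≢w)
    where
    apart : ∀ l l′ → l ≢ l′ → v ≢ w → ¬ (v ∈ₗ Q l × v ∈ₗ Q l′)
    apart 0F 0F l≢l′ = contradiction refl l≢l′
    apart 1F 1F l≢l′ = contradiction refl l≢l′
    apart 2F 2F l≢l′ = contradiction refl l≢l′
    apart 0F 1F _ v≢w = Q₁Q₂ v v≢w
    apart 0F 2F _ v≢w = Q₁Q₃ v v≢w
    apart 1F 2F _ v≢w = Q₂Q₃ v v≢w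
    apart 1F 0F _ v≢w (v∈Q₂ , v∈Q₁) = Q₁Q₂ v v≢w (v∈Q₁ , v∈Q₂)
    apart 2F 0F _ v≢w (v∈Q₃ , v∈Q₁) = Q₁Q₃ v v≢w (v∈Q₁ , v∈Q₃)
    apart 2F 1F _ v≢w (v∈Q₃ , v∈Q₂) = Q₂Q₃ v v≢w (v∈Q₂ , v∈Q₃)

  y∈Q : ∀ l → y l ∈ₗ Q l
  y∈Q l = subst (_∈ₗ Q l) (‼-len (proj₁ (path l))) (‼-∈ (proj₁ (path l)) _)

  end-index : ∀ {v} → v ≡ y₁ ⊎ v ≡ y₂ ⊎ v ≡ y₃ → ∃ λ m → v ≡ y m
  end-index (inj₁ v≡y₁) = 0F , v≡y₁
  end-index (inj₂ (inj₁ v≡y₂)) = 1F , v≡y₂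
  end-index (inj₂ (inj₂ v≡y₃)) = 2F , v≡y₃

  Q∩A : ∀ l {v} → v ∈ₗ Q l → v ∈ A → v ≡ y l
  Q∩A l v∈Q v∈A with end-index (Equivalence.to (A∩T⇔ _) (x∈p∩q⁺ (v∈A , Q⊆T l v∈Q)))
  ... | m , refl with l ≟ m
  ...   | yes refl = refl
  ...   | no l≢m = contradiction (Q-meet l≢m v∈Q (y∈Q m)) (y≢w m)

  three-paths : w ∉ A → Spider H A T
  three-paths = spider path Q-meet Q⊆T y∈A y≢w

  around-the-cycle : InducesCycle H (λ v → v ∈ₗ Q₁ ⊎ v ∈ₗ Q₂) → SeparatingPath H A T
  around-the-cycle cycle =
    separating-path P₁ P₂ cycle (Q-meet {0F} {1F} (λ ())) ([ Q⊆T 0F , Q⊆T 1F ])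
      (λ { (inj₁ v∈Q₁) v∈A → inj₁ (Q∩A 0F v∈Q₁ v∈A) ; (inj₂ v∈Q₂) v∈A → inj₂ (Q∩A 1F v∈Q₂ v∈A) })
      y₁∈A y₂∈A y₁≢w y₂≢w

filler-budget : ∀ {k m N} (A T : Subset k) → suc (suc m) ≡ N → N + 1 ≤ ∣ A ∣ → ∣ A ∩ T ∣ ≡ 3 →
                m ≤ ∣ A ∩ ∁ T ∣
filler-budget {m = m} {N} A T 2+m≡N N<∣A∣ ∣A∩T∣≡3 = ℕ.+-cancelˡ-≤ 3 m ∣ A ∩ ∁ T ∣ (begin
  3 + m                      ≡⟨ ℕ.+-comm 1 (suc (suc m)) ⟩
  suc (suc m) + 1            ≡⟨ cong (_+ 1) 2+m≡N ⟩
  N + 1                      ≤⟨ N<∣A∣ ⟩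
  ∣ A ∣                      ≡⟨ ∣p∣≡∣p∩q∣+∣p∩∁q∣ A T ⟩
  ∣ A ∩ T ∣ + ∣ A ∩ ∁ T ∣    ≡⟨ cong (_+ ∣ A ∩ ∁ T ∣) ∣A∩T∣≡3 ⟩
  3 + ∣ A ∩ ∁ T ∣            ∎)
  where open ℕ.≤-Reasoning

tSttt-size : ∀ t → t * suc (3 * t) ≡ 3 * t * t + t
tSttt-size t = begin
  t * suc (3 * t)   ≡⟨ ℕ.*-suc t (3 * t) ⟩
  t + t * (3 * t)   ≡⟨ cong (t +_) (ℕ.*-comm t (3 * t)) ⟩
  t + 3 * t * t     ≡⟨ ℕ.+-comm t (3 * t * t) ⟩
  3 * t * t + t     ∎
  where open ≡-Reasoning

tS₀-representation : ∀ H → IntersectsTo H (tSttt-V 0) (tSttt-E 0)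
tS₀-representation H =
  FromSeparatingEmbeddings.intersectsTo H (tSttt-E 0) edge? code decode decode-code {k = 0}
    (λ _ → empty) λ { (() , _) }
  where
  empty : Embedding H (tSttt-E 0)
  empty = record { map = λ { (() , _) } ; injective = λ { {() , _} } ; preserves = λ { {() , _} } }

lemma10 : (t : ℕ) (H : Graph) (A T : Subset (n H))
          (w y₁ y₂ y₃ : Fin (n H)) (Q₁ Q₂ Q₃ : List (Fin (n H))) →
          (∀ v → v ∈ A ⊎ v ∈ T) →
          3 * t * t + t + 1 ≤ ∣ A ∣ →
          (∀ u v → u ∈ A → v ∈ A → u ≢ v → adj H u v ≡ true) →
          (∀ v → v ∈ T ⇔ (v ∈ₗ Q₁ ⊎ v ∈ₗ Q₂ ⊎ v ∈ₗ Q₃)) →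
          IsPath H w y₁ Q₁ → IsPath H w y₂ Q₂ → IsPath H w y₃ Q₃ →
          w ∉ A → y₁ ∈ A → y₂ ∈ A → y₃ ∈ A →
          (∀ v → v ≢ w → ¬ (v ∈ₗ Q₁ × v ∈ₗ Q₂)) →
          (∀ v → v ≢ w → ¬ (v ∈ₗ Q₁ × v ∈ₗ Q₃)) →
          (∀ v → v ≢ w → ¬ (v ∈ₗ Q₂ × v ∈ₗ Q₃)) →
          deg H w ≡ 3 →
          ∣ A ∩ T ∣ ≡ 3 →
          (∀ v → v ∈ A ∩ T ⇔ (v ≡ y₁ ⊎ v ≡ y₂ ⊎ v ≡ y₃)) →
          y₁ ≢ w → y₂ ≢ w → y₃ ≢ w →
          InducesCycle H (λ v → v ∈ₗ Q₁ ⊎ v ∈ₗ Q₂) →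
          (∀ u v → u ∈ A → u ∉ T → v ∈ T → v ∉ A → adj H u v ≡ false) →
          IntersectsTo H (tSttt-V t) (tSttt-E t)
lemma10 t H A T w y₁ y₂ y₃ Q₁ Q₂ Q₃ _ ∣A∣-bound clique T⇔ P₁ P₂ P₃ w∉A y₁∈A y₂∈A y₃∈A
        Q₁Q₂ Q₁Q₃ Q₂Q₃ _ ∣A∩T∣≡3 A∩T⇔ y₁≢w y₂≢w y₃≢w cycle anti with t
... | zero = tS₀-representation H
... | suc t′ = representation t′ (three-paths w∉A) (around-the-cycle cycle)
    (filler H A T code code-injective (filler-budget A T (tSttt-size (suc t′)) ∣A∣-bound ∣A∩T∣≡3))
  where
  open Embeddings H A T clique anti
  open Configuration T⇔ P₁ P₂ P₃ y₁∈A y₂∈A y₃∈A Q₁Q₂ Q₁Q₃ Q₂Q₃ A∩T⇔ y₁≢w y₂≢w y₃≢w
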